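{- For every $n\ge 1$, the coefficient of $x^1$ in $P_{n+1,\underline{1}32}(x)=\sum_{\sigma\in S_{n+1}}x^{pmp_{\underline{1}32}(\sigma)}$ equals $\sum_{\sigma\in S_n(132)} inv(\sigma)$.
   Context: For $\sigma=\sigma_1\cdots\sigma_N\in S_N$, $\sigma$ has a $\underline{1}32$-match at position $\ell$ if there exist $j,m$ with $\ell<j<m$ and $\sigma_\ell<\sigma_m<\sigma_j$; $pmp_{\underline{1}32}(\sigma)$ is the number of such positions $\ell$. $S_n(132)$ denotes the set of permutations in $S_n$ avoiding the classical pattern $132$ (no $a<b<c$ with $\sigma_a<\sigma_c<\sigma_b$), and $inv(\sigma)$ is the number of inversions of $\sigma$, i.e. pairs $a<b$ with $\sigma_a>\sigma_b$. -}

module Defs where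

open import Data.Bool using (Bool; true; false; _∧_; not; if_then_else_)
open import Data.Nat using (ℕ; zero; suc; _<ᵇ_; _≡ᵇ_)
open import Data.Fin using (Fin; toℕ)
open import Data.List using (List; []; _∷_; length; map; concatMap; upTo; allFin; lookup; filterᵇ)
open import Data.Bool.ListAction using (any)
open import Data.Nat.ListAction using (sum)

-- Permutations of size N are represented in one-line notation as lists
-- σ₁ ⋯ σ_N of length N with pairwise distinct entries from {0,…,N-1}.
-- (Using values 0..N-1 instead of 1..N does not affect any order pattern.)

words : ℕ → ℕ → List (List ℕ)
words zero    N = [] ∷ []
words (suc k) N = concatMap (λ a → map (a ∷_) (words k N)) (upTo N)

distinct : List ℕ → Bool
distinct σ = not (any (λ i → any (λ j →
                (toℕ i <ᵇ toℕ j) ∧ (lookup σ i ≡ᵇ lookup σ j))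
              (allFin (length σ))) (allFin (length σ)))

S : ℕ → List (List ℕ)
S N = filterᵇ distinct (words N N)

match132At : (σ : List ℕ) → Fin (length σ) → Bool
match132At σ l = any (λ j → any (λ m →
    (toℕ l <ᵇ toℕ j) ∧ (toℕ j <ᵇ toℕ m)
      ∧ (lookup σ l <ᵇ lookup σ m) ∧ (lookup σ m <ᵇ lookup σ j))
  (allFin (length σ))) (allFin (length σ))

pmp132 : List ℕ → ℕ
pmp132 σ = sum (map (λ l → if match132At σ l then 1 else 0) (allFin (length σ)))

contains132 : List ℕ → Bool
contains132 σ = any (λ a → any (λ b → any (λ c →
    (toℕ a <ᵇ toℕ b) ∧ (toℕ b <ᵇ toℕ c)
      ∧ (lookup σ a <ᵇ lookup σ c) ∧ (lookup σ c <ᵇ lookup σ b))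
  (allFin (length σ))) (allFin (length σ))) (allFin (length σ))

S132 : ℕ → List (List ℕ)
S132 n = filterᵇ (λ σ → not (contains132 σ)) (S n)

inv : List ℕ → ℕ
inv σ = sum (map (λ a → sum (map (λ b →
    if (toℕ a <ᵇ toℕ b) ∧ (lookup σ b <ᵇ lookup σ a) then 1 else 0)
  (allFin (length σ)))) (allFin (length σ)))

coeffP132 : ℕ → ℕ → ℕ
coeffP132 N k = length (filterᵇ (λ σ → pmp132 σ ≡ᵇ k) (S N))

-- A permutation σ of size n + 1 with a single 1̲32-match position ℓ shrinks to τ ∈ S_n(132) by
-- deleting σ_ℓ and closing the gap in the values.  The value σ_ℓ + 1 sits at a position p > ℓ + 1,
-- and σ_{ℓ+1} > σ_ℓ + 1, since otherwise a second match would appear; so (ℓ, p − 1) is an inversion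
-- of τ.  Conversely, for an inversion (a, b) of τ ∈ S_n(132), inserting the value τ_b at position a
-- (raising all values ≥ τ_b) yields σ with the match σ_a < σ_{b+1} < σ_{a+1}, and any other match
-- of σ would leave a 132 in τ.  The two maps are mutually inverse, so both sides of the identity
-- count the same set.

module Submission where

open import Defs
open import Data.Bool using (Bool; true; false; _∧_; not; if_then_else_; T)
open import Data.Bool.Properties using (T-∧; T-≡; T-not-≡; T?)
open import Data.Fin using (Fin; toℕ) renaming (zero to fzero; suc to fsuc)
open import Data.List
  using (List; []; _∷_; _++_; length; map; concatMap; upTo; allFin; lookup; filter; filterᵇ; tabulate; applyUpTo)
open import Data.List.Properties
  using (map-tabulate; tabulate-cong; map-upTo; length-++; length-map; length-upTo; map-cong; map-∘; map-id-local;
         filter-notAll)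
open import Data.Bool.ListAction using (any; or)
open import Data.Nat using (ℕ; zero; suc; pred; >-nonZero; _≤_; _<_; z≤n; s≤s; _<ᵇ_; _≡ᵇ_; _+_)
open import Data.Nat.ListAction using (sum)
open import Data.Nat.Properties
open import Data.List.Relation.Unary.Any using (here; there)
open import Data.List.Relation.Unary.Any.Properties using (any⁺; any⁻)
open import Data.List.Relation.Unary.All as All using (All; []; _∷_)
open import Data.List.Relation.Unary.Unique.Propositional using (Unique; []; _∷_)
import Data.List.Relation.Unary.Unique.Propositional.Properties as Unique
open import Data.List.Membership.Propositional using (_∈_; find; lose)
open import Data.List.Membership.DecPropositional _≟_ using (_∈?_)
open import Data.List.Membership.Propositional.Properties
  using (∈-upTo⁺; ∈-upTo⁻; ∈-filter⁺; ∈-filter⁻; ∈-map⁺; ∈-map⁻; ∈-++⁺ˡ; ∈-++⁺ʳ; ∈-++⁻; ∈-∃++;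
         ∈-concatMap⁺; ∈-concatMap⁻)
open import Data.Product using (∃-syntax; _×_; _,_; proj₁; proj₂; uncurry)
open import Data.Sum using (inj₁; inj₂)
open import Function using (_∘_; id; Equivalence)
open import Relation.Nullary using (¬_; yes; no; contradiction)
open import Relation.Nullary.Decidable using (¬?)
open import Relation.Binary.Definitions using (tri<; tri≈; tri>)
open import Relation.Binary.PropositionalEquality
  using (_≡_; _≢_; refl; sym; trans; cong; subst; subst₂; module ≡-Reasoning)

T-not⁺ : ∀ {b} → ¬ T b → T (not b)
T-not⁺ {true}  ¬b = ¬b _
T-not⁺ {false} _  = _

T-not⁻ : ∀ {b} → T (not b) → ¬ T b
T-not⁻ {true} ()

T-≡true : ∀ {b} → T b → b ≡ true
T-≡true = Equivalence.to T-≡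

¬T-≡false : ∀ {b} → ¬ T b → b ≡ false
¬T-≡false = Equivalence.to T-not-≡ ∘ T-not⁺

∧⁻ : ∀ {x y} → T (x ∧ y) → T x × T y
∧⁻ = Equivalence.to T-∧

∧⁺ : ∀ {x y} → T x → T y → T (x ∧ y)
∧⁺ p q = Equivalence.from T-∧ (p , q)

any-upTo⁻ : ∀ (p : ℕ → Bool) n → T (any p (upTo n)) → ∃[ k ] k < n × T (p k)
any-upTo⁻ p n t = let k , k∈ , pk = find (any⁻ p (upTo n) t) in k , ∈-upTo⁻ k∈ , pk

any-upTo⁺ : ∀ (p : ℕ → Bool) {n k} → k < n → T (p k) → T (any p (upTo n))
any-upTo⁺ p k<n pk = any⁺ p (lose (∈-upTo⁺ k<n) pk)

-- ℕ-indexed reformulation of the definitions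

-- Out-of-range positions read as 0; every use below is guarded by a bound.
get : List ℕ → ℕ → ℕ
get []       _       = 0
get (x ∷ xs) zero    = x
get (x ∷ xs) (suc i) = get xs i

lookup≡get : (σ : List ℕ) (i : Fin (length σ)) → lookup σ i ≡ get σ (toℕ i)
lookup≡get (x ∷ σ) fzero    = refl
lookup≡get (x ∷ σ) (fsuc i) = lookup≡get σ i

tabulate-∘toℕ : ∀ {B : Set} n (f : ℕ → B) → tabulate {n = n} (f ∘ toℕ) ≡ applyUpTo f n
tabulate-∘toℕ zero    f = refl
tabulate-∘toℕ (suc n) f = cong (f 0 ∷_) (tabulate-∘toℕ n (f ∘ suc))

map-allFin≡map-upTo : ∀ {B : Set} n {f : Fin n → B} {g : ℕ → B} →
                      (∀ i → f i ≡ g (toℕ i)) → map f (allFin n) ≡ map g (upTo n)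
map-allFin≡map-upTo n {f} {g} f≗g = begin
  map f (allFin n)       ≡⟨ map-tabulate id f ⟩
  tabulate f             ≡⟨ tabulate-cong f≗g ⟩
  tabulate (g ∘ toℕ)     ≡⟨ tabulate-∘toℕ n g ⟩
  applyUpTo g n          ≡⟨ map-upTo g n ⟨
  map g (upTo n)         ∎
  where open ≡-Reasoning

indicator : Bool → ℕ
indicator b = if b then 1 else 0

sum-indicator≡length-filterᵇ : ∀ {A : Set} (q : A → Bool) xs →
                               sum (map (indicator ∘ q) xs) ≡ length (filterᵇ q xs)
sum-indicator≡length-filterᵇ q []       = refl
sum-indicator≡length-filterᵇ q (x ∷ xs) with q x
... | true  = cong suc (sum-indicator≡length-filterᵇ q xs)
... | false = sum-indicator≡length-filterᵇ q xs

matchᵇ : List ℕ → ℕ → Bool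
matchᵇ σ l = any (λ j → any (λ m →
    (l <ᵇ j) ∧ (j <ᵇ m) ∧ (get σ l <ᵇ get σ m) ∧ (get σ m <ᵇ get σ j))
  (upTo (length σ))) (upTo (length σ))

match132At≡matchᵇ : (σ : List ℕ) (l : Fin (length σ)) → match132At σ l ≡ matchᵇ σ (toℕ l)
match132At≡matchᵇ σ l =
  cong or (map-allFin≡map-upTo _ λ j → cong or (map-allFin≡map-upTo _ λ m → entries j m))
  where
  entries : ∀ j m →
    ((toℕ l <ᵇ toℕ j) ∧ (toℕ j <ᵇ toℕ m) ∧ (lookup σ l <ᵇ lookup σ m) ∧ (lookup σ m <ᵇ lookup σ j))
    ≡ ((toℕ l <ᵇ toℕ j) ∧ (toℕ j <ᵇ toℕ m)
        ∧ (get σ (toℕ l) <ᵇ get σ (toℕ m)) ∧ (get σ (toℕ m) <ᵇ get σ (toℕ j)))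
  entries j m rewrite lookup≡get σ l | lookup≡get σ j | lookup≡get σ m = refl

pmp132≡length-filter : (σ : List ℕ) → pmp132 σ ≡ length (filterᵇ (matchᵇ σ) (upTo (length σ)))
pmp132≡length-filter σ = trans
  (cong sum (map-allFin≡map-upTo _ {g = indicator ∘ matchᵇ σ} λ l →
    cong indicator (match132At≡matchᵇ σ l)))
  (sum-indicator≡length-filterᵇ (matchᵇ σ) (upTo (length σ)))

contains132≡any-matchᵇ : (σ : List ℕ) → contains132 σ ≡ any (matchᵇ σ) (upTo (length σ))
contains132≡any-matchᵇ σ = cong or (map-allFin≡map-upTo _ (match132At≡matchᵇ σ))

distinctᵇ : List ℕ → Bool
distinctᵇ σ = not (any (λ i → any (λ j → (i <ᵇ j) ∧ (get σ i ≡ᵇ get σ j))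
  (upTo (length σ))) (upTo (length σ)))

distinct≡distinctᵇ : (σ : List ℕ) → distinct σ ≡ distinctᵇ σ
distinct≡distinctᵇ σ =
  cong (not ∘ or) (map-allFin≡map-upTo _ λ i → cong or (map-allFin≡map-upTo _ λ j → entries i j))
  where
  entries : ∀ i j → ((toℕ i <ᵇ toℕ j) ∧ (lookup σ i ≡ᵇ lookup σ j))
                    ≡ ((toℕ i <ᵇ toℕ j) ∧ (get σ (toℕ i) ≡ᵇ get σ (toℕ j)))
  entries i j rewrite lookup≡get σ i | lookup≡get σ j = refl

inversionᵇ : List ℕ → ℕ → ℕ → Bool
inversionᵇ σ a b = (a <ᵇ b) ∧ (get σ b <ᵇ get σ a)

inv≡sum-length-filter : (σ : List ℕ) →
  inv σ ≡ sum (map (λ a → length (filterᵇ (inversionᵇ σ a) (upTo (length σ)))) (upTo (length σ)))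
inv≡sum-length-filter σ = cong sum (map-allFin≡map-upTo _ λ a → trans
  (cong sum (map-allFin≡map-upTo _ {g = indicator ∘ inversionᵇ σ (toℕ a)} (entry a)))
  (sum-indicator≡length-filterᵇ (inversionᵇ σ (toℕ a)) (upTo (length σ))))
  where
  entry : ∀ a b → (if (toℕ a <ᵇ toℕ b) ∧ (lookup σ b <ᵇ lookup σ a) then 1 else 0)
                  ≡ indicator (inversionᵇ σ (toℕ a) (toℕ b))
  entry a b rewrite lookup≡get σ a | lookup≡get σ b = refl

record Match (σ : List ℕ) (l : ℕ) : Set where
  constructor match
  field
    j m     : ℕ
    l<j     : l < j
    j<m     : j < m
    m<len   : m < length σ
    σl<σm   : get σ l < get σ m
    σm<σj   : get σ m < get σ j

Match⇒<length : ∀ {σ l} → Match σ l → l < length σ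
Match⇒<length (match _ _ l<j j<m m<len _ _) = <-trans l<j (<-trans j<m m<len)

matchᵇ⇒Match : ∀ σ l → T (matchᵇ σ l) → Match σ l
matchᵇ⇒Match σ l t =
  let j , _ , tj = any-upTo⁻ _ (length σ) t
      m , m< , tm = any-upTo⁻ _ (length σ) tj
      l<j , tm₁ = ∧⁻ {l <ᵇ j} tm
      j<m , tm₂ = ∧⁻ {j <ᵇ m} tm₁
      lm , mj = ∧⁻ {get σ l <ᵇ get σ m} tm₂
  in match j m (<ᵇ⇒< _ _ l<j) (<ᵇ⇒< _ _ j<m) m< (<ᵇ⇒< _ _ lm) (<ᵇ⇒< _ _ mj)

Match⇒matchᵇ : ∀ σ l → Match σ l → T (matchᵇ σ l)
Match⇒matchᵇ σ l (match j m l<j j<m m<len lm mj) =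
  any-upTo⁺ _ (<-trans j<m m<len) (any-upTo⁺ _ m<len
    (∧⁺ (<⇒<ᵇ l<j) (∧⁺ (<⇒<ᵇ j<m) (∧⁺ (<⇒<ᵇ lm) (<⇒<ᵇ mj)))))

Avoids132 : List ℕ → Set
Avoids132 σ = ∀ l → ¬ Match σ l

avoids132⁻ : ∀ σ → T (not (contains132 σ)) → Avoids132 σ
avoids132⁻ σ t l M rewrite contains132≡any-matchᵇ σ =
  T-not⁻ t (any-upTo⁺ (matchᵇ σ) (Match⇒<length M) (Match⇒matchᵇ σ l M))

avoids132⁺ : ∀ σ → Avoids132 σ → T (not (contains132 σ))
avoids132⁺ σ av rewrite contains132≡any-matchᵇ σ = T-not⁺ λ t →
  let l , _ , tl = any-upTo⁻ (matchᵇ σ) (length σ) t in av l (matchᵇ⇒Match σ l tl)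

Distinct : List ℕ → Set
Distinct σ = ∀ {i j} → i < j → j < length σ → get σ i ≢ get σ j

distinct⁻ : ∀ σ → T (distinct σ) → Distinct σ
distinct⁻ σ t i<j j< eq rewrite distinct≡distinctᵇ σ =
  T-not⁻ t (any-upTo⁺ _ (<-trans i<j j<) (any-upTo⁺ _ j< (∧⁺ (<⇒<ᵇ i<j) (≡⇒≡ᵇ _ _ eq))))

distinct⁺ : ∀ σ → Distinct σ → T (distinct σ)
distinct⁺ σ d rewrite distinct≡distinctᵇ σ = T-not⁺ λ t →
  let i , _ , ti = any-upTo⁻ _ (length σ) t
      j , j< , tj = any-upTo⁻ _ (length σ) ti
      i<j , eq = ∧⁻ {i <ᵇ j} tj
  in d (<ᵇ⇒< _ _ i<j) j< (≡ᵇ⇒≡ _ _ eq)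

Unique-⊆⇒length≤ : {A : Set} {xs ys : List A} → Unique xs → (∀ {x} → x ∈ xs → x ∈ ys) →
                   length xs ≤ length ys
Unique-⊆⇒length≤ {xs = []}     _          _   = z≤n
Unique-⊆⇒length≤ {xs = x ∷ xs} (x∉ ∷ uxs) xs⊆ys with ∈-∃++ (xs⊆ys (here refl))
... | us , vs , refl = begin
  suc (length xs)              ≤⟨ s≤s (Unique-⊆⇒length≤ uxs xs⊆us++vs) ⟩
  suc (length (us ++ vs))      ≡⟨ cong suc (length-++ us) ⟩
  suc (length us + length vs)  ≡⟨ +-suc (length us) (length vs) ⟨
  length us + length (x ∷ vs)  ≡⟨ length-++ us ⟨
  length (us ++ x ∷ vs)        ∎
  where
  open ≤-Reasoning
  xs⊆us++vs : ∀ {z} → z ∈ xs → z ∈ us ++ vs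
  xs⊆us++vs {z} z∈xs with ∈-++⁻ us (xs⊆ys (there z∈xs))
  ... | inj₁ z∈us         = ∈-++⁺ˡ z∈us
  ... | inj₂ (here refl)  = contradiction refl (All.lookup x∉ z∈xs)
  ... | inj₂ (there z∈vs) = ∈-++⁺ʳ us z∈vs

module _ {A B : Set} where

  length-concatMap : (f : A → List B) (xs : List A) →
                     length (concatMap f xs) ≡ sum (map (length ∘ f) xs)
  length-concatMap f []       = refl
  length-concatMap f (x ∷ xs) = trans (length-++ (f x)) (cong (length (f x) +_) (length-concatMap f xs))

  Unique-concatMap : (f : A → List B) (π : B → A) {xs : List A} → Unique xs →
                     (∀ x → Unique (f x)) → (∀ x {y} → y ∈ f x → π y ≡ x) →
                     Unique (concatMap f xs)
  Unique-concatMap f π {[]}     []         _  _   = []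
  Unique-concatMap f π {x ∷ xs} (x∉ ∷ uxs) uf tag =
    Unique.++⁺ (uf x) (Unique-concatMap f π uxs uf tag) disjoint
    where
    disjoint : ∀ {y} → ¬ (y ∈ f x × y ∈ concatMap f xs)
    disjoint (y∈fx , y∈rest) =
      let x′ , x′∈xs , y∈fx′ = find (∈-concatMap⁻ f y∈rest)
      in All.lookup x∉ x′∈xs (trans (sym (tag x y∈fx)) (tag x′ y∈fx′))

  length≤-by-injection : (f : A → B) (g : B → A) {xs : List A} {ys : List B} → Unique xs →
                         (∀ {x} → x ∈ xs → f x ∈ ys) → (∀ {x} → x ∈ xs → g (f x) ≡ x) →
                         length xs ≤ length ys
  length≤-by-injection f g {xs} {ys} uxs f∈ys g∘f≡id = begin
    length xs          ≡⟨ length-map f xs ⟨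
    length (map f xs)  ≤⟨ Unique-⊆⇒length≤ unique-image image⊆ys ⟩
    length ys          ∎
    where
    open ≤-Reasoning
    unique-image : Unique (map f xs)
    unique-image = Unique.map⁻ {f = g} (subst Unique (sym (trans (sym (map-∘ {g = g} {f = f} xs))
      (map-id-local (All.tabulate g∘f≡id)))) uxs)
    image⊆ys : ∀ {y} → y ∈ map f xs → y ∈ ys
    image⊆ys y∈ with ∈-map⁻ f y∈
    ... | x , x∈xs , refl = f∈ys x∈xs

length≡-by-bijection : {A B : Set} (f : A → B) (g : B → A) {xs : List A} {ys : List B} →
  Unique xs → Unique ys → (∀ {x} → x ∈ xs → f x ∈ ys) → (∀ {y} → y ∈ ys → g y ∈ xs) →
  (∀ {x} → x ∈ xs → g (f x) ≡ x) → (∀ {y} → y ∈ ys → f (g y) ≡ y) → length xs ≡ length ys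
length≡-by-bijection f g uxs uys f∈ g∈ g∘f f∘g =
  ≤-antisym (length≤-by-injection f g uxs f∈ g∘f) (length≤-by-injection g f uys g∈ f∘g)

Unique-singleton : {A : Set} {zs : List A} {x : A} → Unique zs → x ∈ zs →
                   (∀ {y} → y ∈ zs → y ≡ x) → length zs ≡ 1
Unique-singleton {zs = _ ∷ []}    _        _ _   = refl
Unique-singleton {zs = _ ∷ _ ∷ _} (z∉ ∷ _) _ ≡x = contradiction
  (trans (≡x (here refl)) (sym (≡x (there (here refl))))) (All.head z∉)

module _ {A : Set} (q : A → Bool) where

  length-filterᵇ≡1⁻ : ∀ xs → length (filterᵇ q xs) ≡ 1 →
                      ∃[ x ] x ∈ xs × T (q x) × (∀ {y} → y ∈ xs → T (q y) → y ≡ x)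
  length-filterᵇ≡1⁻ xs len≡1 with filterᵇ q xs in eq
  ... | x ∷ [] = let x∈xs , qx = ∈-filter⁻ (T? ∘ q) {xs = xs} x∈filter
                 in x , x∈xs , qx , only-x
    where
    x∈filter : x ∈ filterᵇ q xs
    x∈filter = subst (x ∈_) (sym eq) (here refl)
    only-x : ∀ {y} → y ∈ xs → T (q y) → y ≡ x
    only-x y∈xs qy with subst (_ ∈_) eq (∈-filter⁺ (T? ∘ q) y∈xs qy)
    ... | here y≡x = y≡x

  length-filterᵇ≡1⁺ : ∀ {xs x} → Unique xs → x ∈ xs → T (q x) →
                      (∀ {y} → y ∈ xs → T (q y) → y ≡ x) → length (filterᵇ q xs) ≡ 1
  length-filterᵇ≡1⁺ {xs} uxs x∈xs qx only-x =
    Unique-singleton (Unique.filter⁺ (T? ∘ q) uxs) (∈-filter⁺ (T? ∘ q) x∈xs qx)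
      λ y∈ → let y∈xs , qy = ∈-filter⁻ (T? ∘ q) {xs = xs} y∈ in only-x y∈xs qy

record IsPerm (N : ℕ) (σ : List ℕ) : Set where
  field
    length≡  : length σ ≡ N
    bounded  : ∀ {i} → i < length σ → get σ i < N
    entries-distinct : Distinct σ

get∈ : (σ : List ℕ) {i : ℕ} → i < length σ → get σ i ∈ σ
get∈ (x ∷ σ) {zero}  _         = here refl
get∈ (x ∷ σ) {suc i} (s≤s i<) = there (get∈ σ i<)

∈⇒get : ∀ {x} (σ : List ℕ) → x ∈ σ → ∃[ i ] i < length σ × get σ i ≡ x
∈⇒get (y ∷ σ) (here refl) = 0 , s≤s z≤n , refl
∈⇒get (y ∷ σ) (there x∈σ) = let i , i< , σi≡x = ∈⇒get σ x∈σ in suc i , s≤s i< , σi≡x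

All⇒bounded : ∀ {N} {σ : List ℕ} → All (_< N) σ → ∀ {i} → i < length σ → get σ i < N
All⇒bounded {σ = σ} all i< = All.lookup all (get∈ σ i<)

bounded⇒All : ∀ {N} (σ : List ℕ) → (∀ {i} → i < length σ → get σ i < N) → All (_< N) σ
bounded⇒All σ bounded = All.tabulate λ x∈σ →
  let _ , i< , σi≡x = ∈⇒get σ x∈σ in subst (_< _) σi≡x (bounded i<)

Distinct⇒Unique : (σ : List ℕ) → Distinct σ → Unique σ
Distinct⇒Unique []      _ = []
Distinct⇒Unique (x ∷ σ) d =
  All.tabulate (λ z∈σ x≡z → let i , i< , σi≡z = ∈⇒get σ z∈σ in
    d {0} {suc i} (s≤s z≤n) (s≤s i<) (trans x≡z (sym σi≡z)))
  ∷ Distinct⇒Unique σ (λ i<j j< → d (s≤s i<j) (s≤s j<))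

IsPerm-surjective : ∀ {N σ} → IsPerm N σ → ∀ {x} → x < N → ∃[ i ] i < length σ × get σ i ≡ x
IsPerm-surjective {N} {σ} p {x} x<N with x ∈? σ
... | yes x∈σ = ∈⇒get σ x∈σ
... | no  x∉σ = contradiction (IsPerm.length≡ p) (<⇒≢ (begin-strict
    length σ        ≤⟨ Unique-⊆⇒length≤ (Distinct⇒Unique σ (IsPerm.entries-distinct p)) σ⊆others ⟩
    length others   <⟨ filter-notAll (¬? ∘ (x ≟_)) (upTo N) (lose (∈-upTo⁺ x<N) λ x≢x → x≢x refl) ⟩
    length (upTo N) ≡⟨ length-upTo N ⟩
    N               ∎))
  where
  open ≤-Reasoning
  others : List ℕ
  others = filter (¬? ∘ (x ≟_)) (upTo N)
  σ⊆others : ∀ {z} → z ∈ σ → z ∈ others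
  σ⊆others z∈σ = ∈-filter⁺ (¬? ∘ (x ≟_)) (∈-upTo⁺ (All.lookup (bounded⇒All σ (IsPerm.bounded p)) z∈σ))
    λ { refl → x∉σ z∈σ }

words-mem⁻ : ∀ k N {σ} → σ ∈ words k N → length σ ≡ k × All (_< N) σ
words-mem⁻ zero    N (here refl) = refl , []
words-mem⁻ (suc k) N σ∈ with find (∈-concatMap⁻ (λ a → map (a ∷_) (words k N)) {xs = upTo N} σ∈)
... | a , a∈ , σ∈′ with ∈-map⁻ (a ∷_) σ∈′
... | τ , τ∈ , refl = let len , all = words-mem⁻ k N τ∈ in cong suc len , ∈-upTo⁻ a∈ ∷ all

words-mem⁺ : ∀ N {σ} → All (_< N) σ → σ ∈ words (length σ) N
words-mem⁺ N []                   = here refl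
words-mem⁺ N {a ∷ σ} (a< ∷ all) =
  ∈-concatMap⁺ (λ b → map (b ∷_) (words (length σ) N))
    (lose (∈-upTo⁺ a<) (∈-map⁺ (a ∷_) (words-mem⁺ N all)))

Unique-words : ∀ k N → Unique (words k N)
Unique-words zero    N = [] ∷ []
Unique-words (suc k) N = Unique-concatMap (λ a → map (a ∷_) (words k N)) head₀ (Unique.upTo⁺ N)
  (λ a → Unique.map⁺ ∷-injectiveʳ (Unique-words k N)) head-tag
  where
  head₀ : List ℕ → ℕ
  head₀ []      = 0
  head₀ (x ∷ _) = x
  ∷-injectiveʳ : ∀ {a} {xs ys : List ℕ} → a ∷ xs ≡ a ∷ ys → xs ≡ ys
  ∷-injectiveʳ refl = refl
  head-tag : ∀ a {σ} → σ ∈ map (a ∷_) (words k N) → head₀ σ ≡ a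
  head-tag a σ∈ with ∈-map⁻ (a ∷_) σ∈
  ... | _ , _ , refl = refl

S-mem⁻ : ∀ N {σ} → σ ∈ S N → IsPerm N σ
S-mem⁻ N {σ} σ∈ =
  let σ∈words , dσ = ∈-filter⁻ (T? ∘ distinct) {xs = words N N} σ∈
      len , all = words-mem⁻ N N σ∈words
  in record { length≡ = len ; bounded = All⇒bounded all ; entries-distinct = distinct⁻ σ dσ }

S-mem⁺ : ∀ N {σ} → IsPerm N σ → σ ∈ S N
S-mem⁺ N {σ} p with IsPerm.length≡ p
... | refl = ∈-filter⁺ (T? ∘ distinct) (words-mem⁺ N (bounded⇒All σ (IsPerm.bounded p)))
               (distinct⁺ σ (IsPerm.entries-distinct p))

Unique-S : ∀ N → Unique (S N)
Unique-S N = Unique.filter⁺ (T? ∘ distinct) (Unique-words N N)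

-- Making room for a value, and closing the gap again

shift : ℕ → ℕ → ℕ
shift v x = if x <ᵇ v then x else suc x

unshift : ℕ → ℕ → ℕ
unshift v x = if v <ᵇ x then pred x else x

data ShiftView (v x : ℕ) : Set where
  below : x < v → shift v x ≡ x     → ShiftView v x
  above : v ≤ x → shift v x ≡ suc x → ShiftView v x

shift-view : ∀ v x → ShiftView v x
shift-view v x with x <? v
... | yes x<v = below x<v (cong (if_then x else suc x) (T-≡true (<⇒<ᵇ x<v)))
... | no  x≮v = above (≮⇒≥ x≮v) (cong (if_then x else suc x) (¬T-≡false (x≮v ∘ <ᵇ⇒< x v)))

shift-≥ : ∀ {v x} → v ≤ x → shift v x ≡ suc x
shift-≥ {v} {x} v≤x with shift-view v x
... | below x<v _ = contradiction v≤x (<⇒≱ x<v)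
... | above _   e = e

shift-self : ∀ v → shift v v ≡ suc v
shift-self v = shift-≥ ≤-refl

shift-<-mono : ∀ {v x y} → x < y → shift v x < shift v y
shift-<-mono {v} {x} {y} x<y with shift-view v x | shift-view v y
... | below _ e₁   | below _ e₂ rewrite e₁ | e₂ = x<y
... | below _ e₁   | above _ e₂ rewrite e₁ | e₂ = m<n⇒m<1+n x<y
... | above v≤x _  | below y<v _ = contradiction (<-trans (≤-<-trans v≤x x<y) y<v) (<-irrefl refl)
... | above _ e₁   | above _ e₂ rewrite e₁ | e₂ = s≤s x<y

shift-<-cancel : ∀ {v x y} → shift v x < shift v y → x < y
shift-<-cancel {v} {x} {y} lt with <-cmp x y
... | tri< x<y _ _ = x<y
... | tri≈ _ refl _ = contradiction lt (<-irrefl refl)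
... | tri> _ _ y<x = contradiction (shift-<-mono {v} y<x) (<-asym lt)

shift-injective : ∀ {v x y} → shift v x ≡ shift v y → x ≡ y
shift-injective {v} {x} {y} e with <-cmp x y
... | tri< x<y _ _ = contradiction e (<⇒≢ (shift-<-mono {v} x<y))
... | tri≈ _ x≡y _ = x≡y
... | tri> _ _ y<x = contradiction (sym e) (<⇒≢ (shift-<-mono {v} y<x))

shift≢ : ∀ {v x} → shift v x ≢ v
shift≢ {v} {x} e with shift-view v x
... | below x<v e₁ = <-irrefl (trans (sym e₁) e) x<v
... | above v≤x e₁ = <-irrefl (sym (trans (sym e₁) e)) (s≤s v≤x)

shift<⇒< : ∀ {v x} → shift v x < v → x < v
shift<⇒< {v} {x} lt with shift-view v x
... | below x<v _  = x<v
... | above v≤x e₁ = contradiction (m≤n⇒m≤1+n v≤x) (<⇒≱ (subst (_< v) e₁ lt))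

<shift⇒≤ : ∀ {v x} → v < shift v x → v ≤ x
<shift⇒≤ {v} {x} lt with shift-view v x
... | below x<v e₁ = contradiction (subst (v <_) e₁ lt) (<-asym x<v)
... | above v≤x _  = v≤x

shift-< : ∀ {v x n} → x < n → shift v x < suc n
shift-< {v} {x} x<n with shift-view v x
... | below _ e₁ rewrite e₁ = m<n⇒m<1+n x<n
... | above _ e₁ rewrite e₁ = s≤s x<n

unshift-≤ : ∀ {v x} → x ≤ v → unshift v x ≡ x
unshift-≤ {v} {x} x≤v = cong (if_then pred x else x) (¬T-≡false λ t → <⇒≱ (<ᵇ⇒< v x t) x≤v)

unshift-> : ∀ {v x} → v < x → unshift v x ≡ pred x
unshift-> {v} {x} v<x = cong (if_then pred x else x) (T-≡true (<⇒<ᵇ v<x))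

unshift-suc : ∀ v → unshift v (suc v) ≡ v
unshift-suc v = unshift-> ≤-refl

unshift-shift : ∀ v x → unshift v (shift v x) ≡ x
unshift-shift v x with shift-view v x
... | below x<v e rewrite e = unshift-≤ (<⇒≤ x<v)
... | above v≤x e rewrite e = unshift-> (s≤s v≤x)

shift-unshift : ∀ {v x} → x ≢ v → shift v (unshift v x) ≡ x
shift-unshift {v} {x} x≢v with <-cmp v x
... | tri< v<x@(s≤s v≤x′) _ _ rewrite unshift-> v<x = shift-≥ v≤x′
... | tri≈ _ v≡x _ = contradiction (sym v≡x) x≢v
... | tri> _ _ x<v rewrite unshift-≤ (<⇒≤ x<v) = cong (if_then x else suc x) (T-≡true (<⇒<ᵇ x<v))

unshift-<-cancel : ∀ {v x y} → x ≢ v → y ≢ v → unshift v x < unshift v y → x < y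
unshift-<-cancel {v} x≢v y≢v lt =
  subst₂ _<_ (shift-unshift x≢v) (shift-unshift y≢v) (shift-<-mono {v} lt)

unshift-injective : ∀ {v x y} → x ≢ v → y ≢ v → unshift v x ≡ unshift v y → x ≡ y
unshift-injective {v} x≢v y≢v e =
  trans (sym (shift-unshift x≢v)) (trans (cong (shift v) e) (shift-unshift y≢v))

unshift-< : ∀ {v x n} → x < suc n → x ≢ v → v < suc n → unshift v x < n
unshift-< {v} {x} {n} x<1+n x≢v v<1+n with <-cmp v x
... | tri< v<x@(s≤s _) _ _ rewrite unshift-> v<x = ≤-pred x<1+n
... | tri≈ _ v≡x _ = contradiction (sym v≡x) x≢v
... | tri> _ _ x<v rewrite unshift-≤ (<⇒≤ x<v) = <-≤-trans x<v (≤-pred v<1+n)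

shift-suc : ∀ v x → shift (suc v) (suc x) ≡ suc (shift v x)
shift-suc v x with x <ᵇ v
... | true  = refl
... | false = refl

insert : ℕ → ℕ → List ℕ → List ℕ
insert zero    v xs       = v ∷ xs
insert (suc a) v []       = v ∷ []
insert (suc a) v (x ∷ xs) = x ∷ insert a v xs

remove : ℕ → List ℕ → List ℕ
remove _       []       = []
remove zero    (x ∷ xs) = xs
remove (suc l) (x ∷ xs) = x ∷ remove l xs

length-insert : ∀ a v xs → length (insert a v xs) ≡ suc (length xs)
length-insert zero    v xs       = refl
length-insert (suc a) v []       = refl
length-insert (suc a) v (x ∷ xs) = cong suc (length-insert a v xs)

length-remove : ∀ l xs → l < length xs → suc (length (remove l xs)) ≡ length xs
length-remove zero    (x ∷ xs) _         = refl
length-remove (suc l) (x ∷ xs) (s≤s l<) = cong suc (length-remove l xs l<)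

get-insert-self : ∀ a v xs → a ≤ length xs → get (insert a v xs) a ≡ v
get-insert-self zero    v xs       _         = refl
get-insert-self (suc a) v (x ∷ xs) (s≤s a≤) = get-insert-self a v xs a≤

get-insert-shift : ∀ a v xs t → a ≤ length xs → get (insert a v xs) (shift a t) ≡ get xs t
get-insert-shift zero    v xs       t       _         = refl
get-insert-shift (suc a) v (x ∷ xs) zero    _         = refl
get-insert-shift (suc a) v (x ∷ xs) (suc t) (s≤s a≤) rewrite shift-suc a t =
  get-insert-shift a v xs t a≤

get-remove : ∀ l xs t → get (remove l xs) t ≡ get xs (shift l t)
get-remove l       []       t       = refl
get-remove zero    (x ∷ xs) t       = refl
get-remove (suc l) (x ∷ xs) zero    = refl
get-remove (suc l) (x ∷ xs) (suc t) rewrite shift-suc l t = get-remove l xs t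

insert-remove : ∀ l xs → l < length xs → insert l (get xs l) (remove l xs) ≡ xs
insert-remove zero    (x ∷ xs) _         = refl
insert-remove (suc l) (x ∷ xs) (s≤s l<) = cong (x ∷_) (insert-remove l xs l<)

remove-insert : ∀ a v xs → a ≤ length xs → remove a (insert a v xs) ≡ xs
remove-insert zero    v xs       _         = refl
remove-insert (suc a) v (x ∷ xs) (s≤s a≤) = cong (x ∷_) (remove-insert a v xs a≤)

get-map : ∀ (f : ℕ → ℕ) xs {i} → i < length xs → get (map f xs) i ≡ f (get xs i)
get-map f (x ∷ xs) {zero}  _         = refl
get-map f (x ∷ xs) {suc i} (s≤s i<) = get-map f xs i<

map-unshift-shift : ∀ v xs → map (unshift v) (map (shift v) xs) ≡ xs
map-unshift-shift v xs =
  trans (sym (map-∘ xs)) (map-id-local (All.tabulate λ {x} _ → unshift-shift v x))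

map-shift-unshift : ∀ v xs → All (_≢ v) xs → map (shift v) (map (unshift v) xs) ≡ xs
map-shift-unshift v xs ≢v = trans (sym (map-∘ xs)) (map-id-local (All.map shift-unshift ≢v))

firstIndex : (ℕ → Bool) → ℕ → ℕ
firstIndex p zero    = 0
firstIndex p (suc n) = if p 0 then 0 else suc (firstIndex (p ∘ suc) n)

firstIndex-≡ : ∀ p n k → k < n → T (p k) → (∀ {i} → i < k → ¬ T (p i)) → firstIndex p n ≡ k
firstIndex-≡ p (suc n) zero    _         pk _      rewrite T-≡true pk = refl
firstIndex-≡ p (suc n) (suc k) (s≤s k<) pk before rewrite ¬T-≡false (before {0} (s≤s z≤n)) =
  cong suc (firstIndex-≡ (p ∘ suc) n k k< pk (before ∘ s≤s))

-- The bijection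

-- The positions 0 … n after an entry has been inserted at position a.
data Position (a n : ℕ) : ℕ → Set where
  inserted : Position a n a
  shifted  : ∀ {t} → t < n → Position a n (shift a t)

position : ∀ {a n} k → a < suc n → k < suc n → Position a n k
position {a} {n} k a< k< with k ≟ a
... | yes refl = inserted
... | no  k≢a  = subst (Position a n) (shift-unshift k≢a) (shifted (unshift-< k< k≢a a<))

fromInversion : List ℕ × ℕ × ℕ → List ℕ
fromInversion (τ , a , b) = insert a (get τ b) (map (shift (get τ b)) τ)

toInversionAt : List ℕ → ℕ → List ℕ × ℕ × ℕ
toInversionAt σ ℓ = map (unshift (get σ ℓ)) (remove ℓ σ) , ℓ ,
                    pred (firstIndex (λ i → get σ i ≡ᵇ suc (get σ ℓ)) (length σ))

toInversion : List ℕ → List ℕ × ℕ × ℕ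
toInversion σ = toInversionAt σ (firstIndex (matchᵇ σ) (length σ))

record UniqueMatch (σ : List ℕ) : Set where
  constructor uniqueMatch
  field
    ℓ      : ℕ
    at-ℓ   : Match σ ℓ
    only-ℓ : ∀ {l} → Match σ l → l ≡ ℓ

toInversion-uniqueMatch : ∀ σ (u : UniqueMatch σ) → toInversion σ ≡ toInversionAt σ (UniqueMatch.ℓ u)
toInversion-uniqueMatch σ (uniqueMatch ℓ at-ℓ only-ℓ) = cong (toInversionAt σ)
  (firstIndex-≡ (matchᵇ σ) (length σ) ℓ (Match⇒<length at-ℓ) (Match⇒matchᵇ σ ℓ at-ℓ)
    λ i<ℓ t → <-irrefl (only-ℓ (matchᵇ⇒Match σ _ t)) i<ℓ)

record IsInversion (n : ℕ) (τ : List ℕ) (a b : ℕ) : Set where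
  field
    τ-perm   : IsPerm n τ
    τ-avoids : Avoids132 τ
    a<b      : a < b
    b<n      : b < n
    τb<τa    : get τ b < get τ a

module FromInversion {n τ a b} (inversion : IsInversion n τ a b) where

  open IsInversion inversion
  open IsPerm τ-perm

  v : ℕ
  v = get τ b

  σ : List ℕ
  σ = fromInversion (τ , a , b)

  τ-index : ∀ {t} → t < n → t < length τ
  τ-index = subst (_ <_) (sym length≡)

  a≤length : a ≤ length (map (shift v) τ)
  a≤length = subst (a ≤_) (sym (trans (length-map (shift v) τ) length≡)) (<⇒≤ (<-trans a<b b<n))

  length-σ : length σ ≡ suc n
  length-σ = trans (length-insert a v _) (cong suc (trans (length-map (shift v) τ) length≡))

  σ-index : ∀ {t} → t < n → shift a t < length σ
  σ-index t< = subst (_ <_) (sym length-σ) (shift-< {a} t<)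

  σ-inserted : get σ a ≡ v
  σ-inserted = get-insert-self a v _ a≤length

  σ-shifted : ∀ {t} → t < n → get σ (shift a t) ≡ shift v (get τ t)
  σ-shifted t< = trans (get-insert-shift a v _ _ a≤length) (get-map (shift v) τ (τ-index t<))

  σ-shifted≢v : ∀ {t} → t < n → get σ (shift a t) ≢ v
  σ-shifted≢v t< e = shift≢ (trans (sym (σ-shifted t<)) e)

  σ-position : ∀ {k} → k < length σ → Position a n k
  σ-position {k} k< = position k (m<n⇒m<1+n (<-trans a<b b<n)) (subst (k <_) length-σ k<)

  σ-perm : IsPerm (suc n) σ
  σ-perm = record { length≡ = length-σ ; bounded = σ-bounded ; entries-distinct = σ-distinct }
    where
    σ-bounded : ∀ {k} → k < length σ → get σ k < suc n
    σ-bounded k< with σ-position k<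
    ... | inserted   = subst (_< suc n) (sym σ-inserted) (m<n⇒m<1+n (bounded (τ-index b<n)))
    ... | shifted t< = subst (_< suc n) (sym (σ-shifted t<)) (shift-< {v} (bounded (τ-index t<)))
    σ-distinct : Distinct σ
    σ-distinct {i} {k} i<k k< with σ-position (<-trans i<k k<) | σ-position k<
    ... | inserted   | inserted   = contradiction i<k (<-irrefl refl)
    ... | inserted   | shifted u< = λ e → σ-shifted≢v u< (trans (sym e) σ-inserted)
    ... | shifted t< | inserted   = λ e → σ-shifted≢v t< (trans e σ-inserted)
    ... | shifted t< | shifted u< = λ e → entries-distinct (shift-<-cancel {a} i<k) (τ-index u<)
      (shift-injective {v} (trans (sym (σ-shifted t<)) (trans e (σ-shifted u<))))

  -- The match is σ_a = v < σ_{b+1} = v + 1 < σ_{a+1}.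
  match-at-a : Match σ a
  match-at-a = match (shift a a) (shift a b)
    (subst (a <_) (sym (shift-self a)) ≤-refl) (shift-<-mono {a} a<b) (σ-index b<n)
    (subst₂ _<_ (sym σ-inserted) (sym (σ-shifted b<n)) (subst (v <_) (sym (shift-self v)) ≤-refl))
    (subst₂ _<_ (sym (σ-shifted b<n)) (sym (σ-shifted (<-trans a<b b<n))) (shift-<-mono {v} τb<τa))

  -- Any other match of σ would survive the removal of v as a 132 in τ.
  match-only-at-a : ∀ {l} → Match σ l → l ≡ a
  match-only-at-a {l} M@(match j m l<j j<m m<len σl<σm σm<σj)
    with σ-position (Match⇒<length M) | σ-position (<-trans j<m m<len) | σ-position m<len
  ... | inserted    | _           | _           = refl
  ... | shifted _   | inserted    | inserted    = contradiction j<m (<-irrefl refl)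
  ... | shifted {l′} l′< | inserted | shifted {m′} m′< = contradiction τ-match (τ-avoids l′)
    where
    τm′<v : get τ m′ < v
    τm′<v = shift<⇒< (subst₂ _<_ (σ-shifted m′<) σ-inserted σm<σj)
    a<m′ : a < m′
    a<m′ = ≤∧≢⇒< (<shift⇒≤ j<m) λ { refl → <-asym τm′<v τb<τa }
    τ-match : Match τ l′
    τ-match = match a m′ (shift<⇒< l<j) a<m′ (τ-index m′<)
      (shift-<-cancel {v} (subst₂ _<_ (σ-shifted l′<) (σ-shifted m′<) σl<σm)) (<-trans τm′<v τb<τa)
  ... | shifted {l′} l′< | shifted {j′} j′< | inserted = contradiction τ-match (τ-avoids l′)
    where
    j′<b : j′ < b
    j′<b = <-trans (shift<⇒< j<m) a<b
    τ-match : Match τ l′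
    τ-match = match j′ b (shift-<-cancel {a} l<j) j′<b (τ-index b<n)
      (shift<⇒< (subst₂ _<_ (σ-shifted l′<) σ-inserted σl<σm))
      (≤∧≢⇒< (<shift⇒≤ (subst₂ _<_ σ-inserted (σ-shifted j′<) σm<σj))
        λ v≡τj′ → entries-distinct j′<b (τ-index b<n) (sym v≡τj′))
  ... | shifted {l′} l′< | shifted {j′} j′< | shifted {m′} m′< = contradiction τ-match (τ-avoids l′)
    where
    τ-match : Match τ l′
    τ-match = match j′ m′ (shift-<-cancel {a} l<j) (shift-<-cancel {a} j<m) (τ-index m′<)
      (shift-<-cancel {v} (subst₂ _<_ (σ-shifted l′<) (σ-shifted m′<) σl<σm))
      (shift-<-cancel {v} (subst₂ _<_ (σ-shifted m′<) (σ-shifted j′<) σm<σj))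

  σ-uniqueMatch : UniqueMatch σ
  σ-uniqueMatch = uniqueMatch a match-at-a match-only-at-a

  successor-position : firstIndex (λ i → get σ i ≡ᵇ suc (get σ a)) (length σ) ≡ shift a b
  successor-position = firstIndex-≡ _ (length σ) (shift a b) (σ-index b<n)
    (≡⇒≡ᵇ _ _ (trans (σ-shifted b<n) (trans (shift-self v) (cong suc (sym σ-inserted)))))
    before
    where
    before : ∀ {i} → i < shift a b → ¬ T (get σ i ≡ᵇ suc (get σ a))
    before {i} i< t with σ-position (<-trans i< (σ-index b<n)) | ≡ᵇ⇒≡ (get σ i) _ t
    ... | inserted   | e = <-irrefl e (n<1+n (get σ a))
    ... | shifted u< | e = entries-distinct (shift-<-cancel {a} i<) (τ-index b<n) (shift-injective {v}
      (trans (sym (σ-shifted u<)) (trans e (trans (cong suc σ-inserted) (sym (shift-self v))))))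

  toInversion-fromInversion : toInversion σ ≡ (τ , a , b)
  toInversion-fromInversion
    rewrite toInversion-uniqueMatch σ σ-uniqueMatch | successor-position | shift-≥ {a} (<⇒≤ a<b)
          | σ-inserted | remove-insert a v (map (shift v) τ) a≤length | map-unshift-shift v τ = refl

module ToInversion {n σ} (σ-perm : IsPerm (suc n) σ) (σ-uniqueMatch : UniqueMatch σ) where

  open IsPerm σ-perm
  open UniqueMatch σ-uniqueMatch
  open Match at-ℓ

  v : ℕ
  v = get σ ℓ

  ℓ<length : ℓ < length σ
  ℓ<length = Match⇒<length at-ℓ

  distinct-values : ∀ {i k} → i ≢ k → i < length σ → k < length σ → get σ i ≢ get σ k
  distinct-values {i} {k} i≢k i< k< with <-cmp i k
  ... | tri< i<k _ _ = entries-distinct i<k k<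
  ... | tri≈ _ i≡k _ = contradiction i≡k i≢k
  ... | tri> _ _ k<i = entries-distinct k<i i< ∘ sym

  successor : ∃[ p ] p < length σ × get σ p ≡ suc v
  successor = IsPerm-surjective σ-perm (≤-<-trans σl<σm (bounded m<len))

  p : ℕ
  p = proj₁ successor

  p<length : p < length σ
  p<length = proj₁ (proj₂ successor)

  σp≡1+v : get σ p ≡ suc v
  σp≡1+v = proj₂ (proj₂ successor)

  successor-position : firstIndex (λ i → get σ i ≡ᵇ suc v) (length σ) ≡ p
  successor-position = firstIndex-≡ _ (length σ) p p<length (≡⇒≡ᵇ _ _ σp≡1+v)
    λ i<p t → entries-distinct i<p p<length (trans (≡ᵇ⇒≡ _ _ t) (sym σp≡1+v))

  -- v + 1 cannot stand before σ_j, as it would play the role of the 1 in a second match.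
  j<p : j < p
  j<p with <-cmp j p
  ... | tri< j<p _ _ = j<p
  ... | tri≈ _ refl _ = contradiction (subst (_ <_) σp≡1+v σm<σj) (<⇒≱ (s≤s σl<σm))
  ... | tri> _ _ p<j =
    contradiction (only-ℓ p-match) λ p≡ℓ → 1+n≢n (trans (sym σp≡1+v) (cong (get σ) p≡ℓ))
    where
    p-match : Match σ p
    p-match = match j m p<j j<m m<len
      (subst (_< get σ m) (sym σp≡1+v)
        (≤∧≢⇒< σl<σm λ e → entries-distinct (<-trans p<j j<m) m<len (trans σp≡1+v e)))
      σm<σj

  -- Otherwise ℓ + 1 would be a second match, with the same j and m.
  v<σ[1+ℓ] : v < get σ (suc ℓ)
  v<σ[1+ℓ] with <-cmp (get σ (suc ℓ)) v
  ... | tri> _ _ v<σ[1+ℓ] = v<σ[1+ℓ]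
  ... | tri≈ _ e _ = contradiction (sym e) (entries-distinct ≤-refl (≤-<-trans l<j (<-trans j<m m<len)))
  ... | tri< σ[1+ℓ]<v _ _ with j ≟ suc ℓ
  ...   | yes refl = contradiction σm<σj (<-asym (<-trans σ[1+ℓ]<v σl<σm))
  ...   | no  j≢1+ℓ = contradiction (only-ℓ (match j m (≤∧≢⇒< l<j (j≢1+ℓ ∘ sym)) j<m m<len
                        (<-trans σ[1+ℓ]<v σl<σm) σm<σj)) (<⇒≢ (n<1+n ℓ) ∘ sym)

  1+v<σ[1+ℓ] : suc v < get σ (suc ℓ)
  1+v<σ[1+ℓ] = ≤∧≢⇒< v<σ[1+ℓ] λ e → distinct-values (<⇒≢ (≤-<-trans l<j j<p))
    (≤-<-trans l<j (<-trans j<m m<len)) p<length (trans (sym e) (sym σp≡1+v))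

  τ : List ℕ
  τ = map (unshift v) (remove ℓ σ)

  length-remove≡n : length (remove ℓ σ) ≡ n
  length-remove≡n = suc-injective (trans (length-remove ℓ σ ℓ<length) length≡)

  length-τ : length τ ≡ n
  length-τ = trans (length-map (unshift v) (remove ℓ σ)) length-remove≡n

  σ-index : ∀ {t} → t < n → shift ℓ t < length σ
  σ-index t< = subst (_ <_) (sym length≡) (shift-< {ℓ} t<)

  σ-shifted≢v : ∀ {t} → t < n → get σ (shift ℓ t) ≢ v
  σ-shifted≢v t< = distinct-values (shift≢ {ℓ}) (σ-index t<) ℓ<length

  τ-entry : ∀ {t} → t < n → get τ t ≡ unshift v (get σ (shift ℓ t))
  τ-entry {t} t< = trans (get-map (unshift v) (remove ℓ σ) (subst (t <_) (sym length-remove≡n) t<))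
                         (cong (unshift v) (get-remove ℓ σ t))

  τ-perm : IsPerm n τ
  τ-perm = record { length≡ = length-τ ; bounded = τ-bounded ; entries-distinct = τ-distinct }
    where
    τ-bounded : ∀ {t} → t < length τ → get τ t < n
    τ-bounded t<τ = let t< = subst (_ <_) length-τ t<τ in subst (_< n) (sym (τ-entry t<))
      (unshift-< (bounded (σ-index t<)) (σ-shifted≢v t<) (bounded ℓ<length))
    τ-distinct : Distinct τ
    τ-distinct {t} {u} t<u u<τ e = let u< = subst (_ <_) length-τ u<τ ; t< = <-trans t<u u< in
      entries-distinct (shift-<-mono {ℓ} t<u) (σ-index u<)
        (unshift-injective (σ-shifted≢v t<) (σ-shifted≢v u<)
          (trans (sym (τ-entry t<)) (trans e (τ-entry u<))))

  τ-avoids : Avoids132 τ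
  τ-avoids t (match j′ m′ t<j′ j′<m′ m′<τ τt<τm′ τm′<τj′) = shift≢ {ℓ} (only-ℓ lifted)
    where
    m′< : m′ < n
    m′< = subst (_ <_) length-τ m′<τ
    j′< : j′ < n
    j′< = <-trans j′<m′ m′<
    t< : t < n
    t< = <-trans t<j′ j′<
    lift : ∀ {x y} → x < n → y < n → get τ x < get τ y → get σ (shift ℓ x) < get σ (shift ℓ y)
    lift x< y< lt =
      unshift-<-cancel (σ-shifted≢v x<) (σ-shifted≢v y<) (subst₂ _<_ (τ-entry x<) (τ-entry y<) lt)
    lifted : Match σ (shift ℓ t)
    lifted = match (shift ℓ j′) (shift ℓ m′)
      (shift-<-mono {ℓ} t<j′) (shift-<-mono {ℓ} j′<m′) (σ-index m′<)
      (lift t< m′< τt<τm′) (lift m′< j′< τm′<τj′)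

  c : ℕ
  c = pred p

  1+ℓ<p : suc ℓ < p
  1+ℓ<p = ≤-<-trans l<j j<p

  p≡1+c : p ≡ suc c
  p≡1+c = sym (suc-pred p {{>-nonZero (≤-<-trans z≤n 1+ℓ<p)}})

  ℓ<c : ℓ < c
  ℓ<c = ≤-pred (subst (suc ℓ <_) p≡1+c 1+ℓ<p)

  c<n : c < n
  c<n = ≤-pred (subst₂ _<_ p≡1+c length≡ p<length)

  τc≡v : get τ c ≡ v
  τc≡v = begin
    get τ c                         ≡⟨ τ-entry c<n ⟩
    unshift v (get σ (shift ℓ c))   ≡⟨ cong (unshift v ∘ get σ) (trans (shift-≥ (<⇒≤ ℓ<c)) (sym p≡1+c)) ⟩
    unshift v (get σ p)             ≡⟨ cong (unshift v) σp≡1+v ⟩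
    unshift v (suc v)               ≡⟨ unshift-suc v ⟩
    v                               ∎
    where open ≡-Reasoning

  τc<τℓ : get τ c < get τ ℓ
  τc<τℓ = subst₂ _<_ (sym τc≡v) (sym τℓ≡) (pred-mono-≤ 1+v<σ[1+ℓ])
    where
    τℓ≡ : get τ ℓ ≡ pred (get σ (suc ℓ))
    τℓ≡ = trans (τ-entry (<-trans ℓ<c c<n))
                (trans (cong (unshift v ∘ get σ) (shift-self ℓ)) (unshift-> v<σ[1+ℓ]))

  isInversion : IsInversion n τ ℓ c
  isInversion = record
    { τ-perm = τ-perm ; τ-avoids = τ-avoids ; a<b = ℓ<c ; b<n = c<n ; τb<τa = τc<τℓ }

  toInversion≡ : toInversion σ ≡ (τ , ℓ , c)
  toInversion≡ rewrite toInversion-uniqueMatch σ σ-uniqueMatch | successor-position = refl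

  remove-σ≢v : All (_≢ v) (remove ℓ σ)
  remove-σ≢v = All.tabulate λ x∈ → let t , t< , e = ∈⇒get (remove ℓ σ) x∈ in
    subst (_≢ v) (trans (sym (get-remove ℓ σ t)) e) (σ-shifted≢v (subst (t <_) length-remove≡n t<))

  fromInversion≡ : fromInversion (τ , ℓ , c) ≡ σ
  fromInversion≡ rewrite τc≡v | map-shift-unshift v (remove ℓ σ) remove-σ≢v =
    insert-remove ℓ σ ℓ<length

-- Counting both sides

singleMatch : ℕ → List (List ℕ)
singleMatch n = filterᵇ (λ σ → pmp132 σ ≡ᵇ 1) (S (suc n))

inversionsAt : List ℕ → ℕ → List (List ℕ × ℕ × ℕ)
inversionsAt τ a = map (λ b → τ , a , b) (filterᵇ (inversionᵇ τ a) (upTo (length τ)))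

inversionsOf : List ℕ → List (List ℕ × ℕ × ℕ)
inversionsOf τ = concatMap (inversionsAt τ) (upTo (length τ))

inversions : ℕ → List (List ℕ × ℕ × ℕ)
inversions n = concatMap inversionsOf (S132 n)

sum-inv≡length-inversions : ∀ n → sum (map inv (S132 n)) ≡ length (inversions n)
sum-inv≡length-inversions n = begin
  sum (map inv (S132 n))                     ≡⟨ cong sum (map-cong inv≡ (S132 n)) ⟩
  sum (map (length ∘ inversionsOf) (S132 n)) ≡⟨ length-concatMap inversionsOf (S132 n) ⟨
  length (inversions n)                      ∎
  where
  open ≡-Reasoning
  inv≡ : ∀ τ → inv τ ≡ length (inversionsOf τ)
  inv≡ τ = trans (inv≡sum-length-filter τ) (trans
    (cong sum (map-cong (λ a → sym (length-map (λ b → τ , a , b) (filterᵇ (inversionᵇ τ a) (upTo (length τ)))))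
                        (upTo (length τ))))
    (sym (length-concatMap (inversionsAt τ) (upTo (length τ)))))

singleMatch-mem⁻ : ∀ n {σ} → σ ∈ singleMatch n → IsPerm (suc n) σ × UniqueMatch σ
singleMatch-mem⁻ n {σ} σ∈ =
  let σ∈S , pmp≡1 = ∈-filter⁻ (T? ∘ (λ σ → pmp132 σ ≡ᵇ 1)) {xs = S (suc n)} σ∈
      ℓ , _ , tℓ , only-ℓ = length-filterᵇ≡1⁻ (matchᵇ σ) (upTo (length σ))
                              (trans (sym (pmp132≡length-filter σ)) (≡ᵇ⇒≡ _ _ pmp≡1))
  in S-mem⁻ (suc n) σ∈S , uniqueMatch ℓ (matchᵇ⇒Match σ ℓ tℓ)
       (λ M → only-ℓ (∈-upTo⁺ (Match⇒<length M)) (Match⇒matchᵇ σ _ M))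

singleMatch-mem⁺ : ∀ n {σ} → IsPerm (suc n) σ → UniqueMatch σ → σ ∈ singleMatch n
singleMatch-mem⁺ n {σ} σ-perm (uniqueMatch ℓ at-ℓ only-ℓ) =
  ∈-filter⁺ (T? ∘ (λ σ → pmp132 σ ≡ᵇ 1)) (S-mem⁺ (suc n) σ-perm) (≡⇒≡ᵇ _ _ pmp≡1)
  where
  pmp≡1 : pmp132 σ ≡ 1
  pmp≡1 = trans (pmp132≡length-filter σ) (length-filterᵇ≡1⁺ (matchᵇ σ) (Unique.upTo⁺ _)
    (∈-upTo⁺ (Match⇒<length at-ℓ)) (Match⇒matchᵇ σ ℓ at-ℓ) λ _ t → only-ℓ (matchᵇ⇒Match σ _ t))

inversions-mem⁻ : ∀ n {τ a b} → (τ , a , b) ∈ inversions n → IsInversion n τ a b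
inversions-mem⁻ n x∈ with find (∈-concatMap⁻ inversionsOf {xs = S132 n} x∈)
... | τ , τ∈ , x∈τ with find (∈-concatMap⁻ (inversionsAt τ) {xs = upTo (length τ)} x∈τ)
... | a , _ , x∈a with ∈-map⁻ (λ b → τ , a , b) x∈a
... | b , b∈ , refl =
  let τ∈S , τ-avoids = ∈-filter⁻ (T? ∘ (not ∘ contains132)) {xs = S n} τ∈
      b∈upTo , inv-ab = ∈-filter⁻ (T? ∘ inversionᵇ τ a) {xs = upTo (length τ)} b∈
      τ-perm = S-mem⁻ n τ∈S
      a<b , τb<τa = ∧⁻ {a <ᵇ b} inv-ab
  in record { τ-perm = τ-perm ; τ-avoids = avoids132⁻ τ τ-avoids ; a<b = <ᵇ⇒< _ _ a<b
            ; b<n = subst (b <_) (IsPerm.length≡ τ-perm) (∈-upTo⁻ b∈upTo) ; τb<τa = <ᵇ⇒< _ _ τb<τa }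

inversions-mem⁺ : ∀ n {τ a b} → IsInversion n τ a b → (τ , a , b) ∈ inversions n
inversions-mem⁺ n {τ} {a} {b} inversion =
  ∈-concatMap⁺ inversionsOf (lose τ∈ (∈-concatMap⁺ (inversionsAt τ) (lose (∈-upTo⁺ (<-trans a<b b<τ))
    (∈-map⁺ (λ b → τ , a , b) (∈-filter⁺ (T? ∘ inversionᵇ τ a) (∈-upTo⁺ b<τ) ab-inversion)))))
  where
  open IsInversion inversion
  τ∈ : τ ∈ S132 n
  τ∈ = ∈-filter⁺ (T? ∘ (not ∘ contains132)) (S-mem⁺ n τ-perm) (avoids132⁺ τ τ-avoids)
  b<τ : b < length τ
  b<τ = subst (b <_) (sym (IsPerm.length≡ τ-perm)) b<n
  ab-inversion : T (inversionᵇ τ a b)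
  ab-inversion = ∧⁺ (<⇒<ᵇ a<b) (<⇒<ᵇ τb<τa)

Unique-inversions : ∀ n → Unique (inversions n)
Unique-inversions n =
  Unique-concatMap inversionsOf proj₁ (Unique.filter⁺ _ (Unique-S n)) Unique-inversionsOf first≡
  where
  second≡ : ∀ τ a {x} → x ∈ inversionsAt τ a → proj₁ (proj₂ x) ≡ a
  second≡ τ a x∈ with ∈-map⁻ (λ b → τ , a , b) x∈
  ... | _ , _ , refl = refl
  first≡ : ∀ τ {x} → x ∈ inversionsOf τ → proj₁ x ≡ τ
  first≡ τ x∈ with find (∈-concatMap⁻ (inversionsAt τ) {xs = upTo (length τ)} x∈)
  ... | a , _ , x∈a with ∈-map⁻ (λ b → τ , a , b) x∈a
  ... | _ , _ , refl = refl
  Unique-inversionsOf : ∀ τ → Unique (inversionsOf τ)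
  Unique-inversionsOf τ = Unique-concatMap (inversionsAt τ) (proj₁ ∘ proj₂) (Unique.upTo⁺ (length τ))
    (λ a → Unique.map⁺ (cong (proj₂ ∘ proj₂)) (Unique.filter⁺ _ (Unique.upTo⁺ (length τ))))
    (second≡ τ)

toInversion∈inversions : ∀ {n σ} → IsPerm (suc n) σ → UniqueMatch σ → toInversion σ ∈ inversions n
toInversion∈inversions {n} σ-perm u =
  subst (_∈ inversions n) (sym toInversion≡) (inversions-mem⁺ n isInversion)
  where open ToInversion σ-perm u

fromInversion-toInversion : ∀ {n σ} → IsPerm (suc n) σ → UniqueMatch σ →
                            fromInversion (toInversion σ) ≡ σ
fromInversion-toInversion σ-perm u = trans (cong fromInversion toInversion≡) fromInversion≡
  where open ToInversion σ-perm u

fromInversion∈singleMatch : ∀ {n τ a b} → IsInversion n τ a b →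
                            fromInversion (τ , a , b) ∈ singleMatch n
fromInversion∈singleMatch {n} inversion = singleMatch-mem⁺ n σ-perm σ-uniqueMatch
  where open FromInversion inversion

length-singleMatch≡length-inversions : ∀ n → length (singleMatch n) ≡ length (inversions n)
length-singleMatch≡length-inversions n = length≡-by-bijection toInversion fromInversion
  (Unique.filter⁺ _ (Unique-S (suc n))) (Unique-inversions n) to∈ from∈ from∘to to∘from
  where
  to∈ : ∀ {σ} → σ ∈ singleMatch n → toInversion σ ∈ inversions n
  to∈ σ∈ = uncurry toInversion∈inversions (singleMatch-mem⁻ n σ∈)
  from∘to : ∀ {σ} → σ ∈ singleMatch n → fromInversion (toInversion σ) ≡ σ
  from∘to σ∈ = uncurry fromInversion-toInversion (singleMatch-mem⁻ n σ∈)
  from∈ : ∀ {x} → x ∈ inversions n → fromInversion x ∈ singleMatch n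
  from∈ x∈ = fromInversion∈singleMatch (inversions-mem⁻ n x∈)
  to∘from : ∀ {x} → x ∈ inversions n → toInversion (fromInversion x) ≡ x
  to∘from x∈ = FromInversion.toInversion-fromInversion (inversions-mem⁻ n x∈)

theorem6 : (n : ℕ) → 1 ≤ n → coeffP132 (suc n) 1 ≡ sum (map inv (S132 n))
theorem6 n _ = trans (length-singleMatch≡length-inversions n) (sym (sum-inv≡length-inversions n))
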